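{- Let $p\ge 1$ and let $[b,e]$ be a $(p-1)$-segment of $X^{p-1}$. Let $\pi$ be the permutation of the indices $(b,b+1,\dots,e)$ that produces the stable ordering of the symbols $Q^p[b],Q^p[b+1],\dots,Q^p[e]$ (all occurrences of $\$$ being treated as equal), i.e. for $1\le r\le e-b+1$, $\pi(r)$ is the index in $[b,e]$ of the $r$-th element in that stable sorted order. Then $X^p[b,e]$ is a permutation of $X^{p-1}[b,e]$, and more precisely $X^p[b+r-1]=X^{p-1}[\pi(r)]$ for every $1\le r\le e-b+1$.
   Context: Let $S=\{s_1,\dots,s_m\}$ be strings each of exactly $k$ symbols over a totally ordered alphabet $\Sigma'=\{c_1<\dots<c_\sigma\}$; $s_j[i]$ denotes the $i$-th symbol. Each $s_j$ is terminated by its own sentinel $\$_j$, with $\$_1<\$_2<\dots<\$_m<c_1$. A suffix of $S$ is a pair $\alpha=(l,j)$ with $0\le l\le k$, $1\le j\le m$, representing the $l$-suffix $s_j[k-l+1:k]$ of $s_j$ (empty if $l=0$); its length is $l_\alpha=l$ and its string index is $i_\alpha=j$; there are $(k+1)m$ suffixes. Its extended string is $\bar\alpha=s_j[k-l+1:k]\,\$_j$ (length $l+1$). For an integer $p\ge 0$, the $p$-prefix $\alpha[:p]$ is the prefix of $\bar\alpha$ of length $\min(p,l+1)$. For $p\ge0$, $\alpha\prec_p\beta$ iff (1) $\alpha[:p]$ is lexicographically strictly smaller than $\beta[:p]$, or (2) $\alpha[:p]=\beta[:p]$ and $l_\alpha<l_\beta$, or (3) $\alpha[:p]=\beta[:p]$,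 $l_\alpha=l_\beta$ and $i_\alpha<i_\beta$. The $p$-interleave $X^p$ is the array of length $(k+1)m$ whose $i$-th entry $X^p[i]$ is the $i$-th smallest suffix in the $\prec_p$ order; $X^p[b,e]$ denotes the subarray of positions $b,\dots,e$. A $p$-segment of $X^p$ is a maximal interval $[b,e]$ of positions such that all suffixes $X^p[b],\dots,X^p[e]$ have the same $p$-prefix. For $p\ge1$ and $1\le i\le (k+1)m$, if $X^{p-1}[i]=(l,j)$ then $Q^p[i]$ is the symbol $s_j[k-l+p]$ (the $p$-th symbol of $s_j[k-l+1:k]$) when $l\ge p$, and is a symbol $\$$ smaller than all symbols of $\Sigma'$ when $l<p$. -}

module Defs where

open import Data.Nat as ℕ using (ℕ; zero; suc; _∸_; _+_; _*_)
open import Data.Fin as F using (Fin; toℕ)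
open import Data.Vec using (Vec; toList)
open import Data.List using (List; []; _∷_; _++_; drop; take; map; [_])
open import Data.Maybe using (Maybe; just; nothing)
open import Data.Product using (_×_; _,_; ∃; ∃-syntax; proj₁; proj₂)
open import Data.Sum using (_⊎_)
open import Relation.Nullary using (yes; no)
open import Relation.Binary.PropositionalEquality using (_≡_; _≢_)

data ExtSym (σ m : ℕ) : Set where
  sent : Fin m → ExtSym σ m
  chr  : Fin σ → ExtSym σ m

data _<ₑ_ {σ m : ℕ} : ExtSym σ m → ExtSym σ m → Set where
  sent<sent : ∀ {i j} → i F.< j → sent i <ₑ sent j
  sent<chr  : ∀ {i c} → sent i <ₑ chr c
  chr<chr   : ∀ {c d} → c F.< d → chr c <ₑ chr d

data Lex< {A : Set} (_<_ : A → A → Set) : List A → List A → Set where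
  []<∷  : ∀ {y ys} → Lex< _<_ [] (y ∷ ys)
  head< : ∀ {x y xs ys} → x < y → Lex< _<_ (x ∷ xs) (y ∷ ys)
  tail< : ∀ {x xs ys} → Lex< _<_ xs ys → Lex< _<_ (x ∷ xs) (x ∷ ys)

nth : {A : Set} → List A → ℕ → Maybe A
nth []       _       = nothing
nth (x ∷ xs) zero    = just x
nth (x ∷ xs) (suc n) = nth xs n

module Setup {σ k m : ℕ} (s : Fin m → Vec (Fin σ) k) where

  -- a suffix (l , j), 0 ≤ l ≤ k ; Fin m index j is 0-based (string s_{j+1})
  Suffix : Set
  Suffix = Fin (suc k) × Fin m

  len : Suffix → ℕ
  len (l , j) = toℕ l

  idx : Suffix → Fin m
  idx (l , j) = j

  sufStr : Suffix → List (Fin σ)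
  sufStr (l , j) = drop (k ∸ toℕ l) (toList (s j))

  ext : Suffix → List (ExtSym σ m)
  ext α = map chr (sufStr α) ++ [ sent (idx α) ]

  pre : ℕ → Suffix → List (ExtSym σ m)
  pre p α = take p (ext α)

  data _≺[_]_ (α : Suffix) (p : ℕ) (β : Suffix) : Set where
    by-prefix : Lex< _<ₑ_ (pre p α) (pre p β) → α ≺[ p ] β
    by-length : pre p α ≡ pre p β → len α ℕ.< len β → α ≺[ p ] β
    by-index  : pre p α ≡ pre p β → len α ≡ len β → idx α F.< idx β → α ≺[ p ] β

  N : ℕ
  N = suc k * m

  IsInterleave : ℕ → (Fin N → Suffix) → Set
  IsInterleave p X =
    (∀ α → ∃[ i ] X i ≡ α) × (∀ (i i' : Fin N) → i F.< i' → X i ≺[ p ] X i')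

  IsSegment : ℕ → (Fin N → Suffix) → Fin N → Fin N → Set
  IsSegment p X b e =
    (b F.≤ e)
    × (∀ (i : Fin N) → b F.≤ i → i F.≤ e → pre p (X i) ≡ pre p (X b))
    × (∀ (i : Fin N) → suc (toℕ i) ≡ toℕ b → pre p (X i) ≢ pre p (X b))
    × (∀ (i : Fin N) → toℕ i ≡ suc (toℕ e) → pre p (X i) ≢ pre p (X e))

  -- symbol keys with $ (nothing) below all of Σ' ; all $ are equal
  data _<Q_ : Maybe (Fin σ) → Maybe (Fin σ) → Set where
    $<c : ∀ {c} → nothing <Q just c
    c<c : ∀ {c d} → c F.< d → just c <Q just d

  Qsym : ℕ → Suffix → Maybe (Fin σ)
  Qsym p α with len α ℕ.<? p
  ... | yes _ = nothing
  ... | no _  = nth (sufStr α) (p ∸ 1)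

  Q : ℕ → (Fin N → Suffix) → Fin N → Maybe (Fin σ)
  Q p Xprev i = Qsym p (Xprev i)

  -- π : {0,…,e-b} → positions, is the permutation of [b,e] giving the stable
  -- sort of Q[b..e] (π r is the position of the r-th element in sorted order)
  IsStableSort : (Fin N → Maybe (Fin σ)) → (b e : Fin N)
               → (Fin (suc (toℕ e ∸ toℕ b)) → Fin N) → Set
  IsStableSort key b e π =
    (∀ r → b F.≤ π r × π r F.≤ e)
    × (∀ (i : Fin N) → b F.≤ i → i F.≤ e → ∃[ r ] π r ≡ i)
    × (∀ r r' → r F.< r' →
         (key (π r) <Q key (π r')) ⊎ (key (π r) ≡ key (π r') × π r F.< π r'))

-- Inside a (p-1)-segment all suffixes share their (p-1)-prefix, so ≺_p compares two of them
-- first by their p-th extended symbol, i.e. by Q^p, and on equal symbols exactly as ≺_(p-1)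
-- does: this is the stable sort π. Across the boundaries of the segment the (p-1)-prefixes
-- already differ, so there ≺_p agrees with ≺_(p-1); a counting argument then shows that X^p
-- lists the suffixes of the segment in the same block [b,e] of positions as X^(p-1). Two
-- ≺_p-increasing enumerations of the same finite set coincide, whence X^p[b+r] = X^(p-1)[π r].
module Submission where

open import Defs
open import Data.Nat using (ℕ; suc; _≥_; _∸_; _+_)
open import Data.Fin as F using (Fin; toℕ)
open import Data.Vec using (Vec)
open import Data.Product using (_×_; ∃-syntax)
open import Relation.Binary.PropositionalEquality using (_≡_)

open import Data.Nat as ℕ using (zero; z≤n; s≤s)
import Data.Nat.Properties as ℕₚ
open import Data.Fin using (fromℕ<; inject₁; inject≤)
import Data.Fin.Properties as Fₚ
import Data.Vec.Properties as Vₚ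
open import Data.Vec using (toList)
open import Data.List using (List; []; _∷_; _++_; [_]; take; drop; map; length; fromMaybe)
import Data.List.Properties as Lₚ
open import Data.Maybe as Maybe using (Maybe; just; nothing)
open import Data.Product using (_,_; proj₁; proj₂; uncurry)
open import Data.Sum using (_⊎_; inj₁; inj₂)
open import Data.Empty using (⊥-elim)
open import Function using (_∘_)
open import Function.Definitions using (Injective)
open import Relation.Nullary using (yes; no; ¬_)
open import Relation.Binary.Core using (_Preserves_⟶_)
open import Relation.Binary.Definitions using (tri<; tri≈; tri>)
open import Relation.Binary.PropositionalEquality
  using (_≢_; refl; sym; trans; cong; cong₂; subst; subst₂; module ≡-Reasoning)

module _ {A : Set} where

  nth-++ˡ : ∀ (xs ys : List A) {i} → i ℕ.< length xs → nth (xs ++ ys) i ≡ nth xs i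
  nth-++ˡ (x ∷ xs) ys {zero}  _         = refl
  nth-++ˡ (x ∷ xs) ys {suc i} (s≤s i<n) = nth-++ˡ xs ys i<n

  nth-++-length : ∀ (xs : List A) y ys → nth (xs ++ y ∷ ys) (length xs) ≡ just y
  nth-++-length []       y ys = refl
  nth-++-length (x ∷ xs) y ys = nth-++-length xs y ys

  nth-map : ∀ {B : Set} (f : A → B) xs i → nth (map f xs) i ≡ Maybe.map f (nth xs i)
  nth-map f []       i       = refl
  nth-map f (x ∷ xs) zero    = refl
  nth-map f (x ∷ xs) (suc i) = nth-map f xs i

  nth-beyond : ∀ (xs : List A) {i} → length xs ℕ.≤ i → nth xs i ≡ nothing
  nth-beyond []       _         = refl
  nth-beyond (x ∷ xs) (s≤s n≤i) = nth-beyond xs n≤i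

  nth-nothing⇒≤ : ∀ (xs : List A) i → nth xs i ≡ nothing → length xs ℕ.≤ i
  nth-nothing⇒≤ []       i       _  = z≤n
  nth-nothing⇒≤ (x ∷ xs) zero    ()
  nth-nothing⇒≤ (x ∷ xs) (suc i) eq = s≤s (nth-nothing⇒≤ xs i eq)

  nth-just⇒< : ∀ (xs : List A) i {x} → nth xs i ≡ just x → i ℕ.< length xs
  nth-just⇒< (y ∷ xs) zero    _  = s≤s z≤n
  nth-just⇒< (y ∷ xs) (suc i) eq = s≤s (nth-just⇒< xs i eq)

  take-suc : ∀ q (xs : List A) → take (suc q) xs ≡ take q xs ++ fromMaybe (nth xs q)
  take-suc zero    []       = refl
  take-suc zero    (x ∷ xs) = refl
  take-suc (suc q) []       = refl
  take-suc (suc q) (x ∷ xs) = cong (x ∷_) (take-suc q xs)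

module _ {A : Set} {_<_ : A → A → Set} where

  Lex<-++ˡ : ∀ (zs : List A) {us vs} → Lex< _<_ us vs → Lex< _<_ (zs ++ us) (zs ++ vs)
  Lex<-++ˡ []       u<v = u<v
  Lex<-++ˡ (z ∷ zs) u<v = tail< (Lex<-++ˡ zs u<v)

  Lex<-take-suc : ∀ q (xs ys : List A) →
    Lex< _<_ (take q xs) (take q ys) → Lex< _<_ (take (suc q) xs) (take (suc q) ys)
  Lex<-take-suc (suc q) []       (y ∷ ys) _          = []<∷
  Lex<-take-suc (suc q) (x ∷ xs) (y ∷ ys) (head< x<y) = head< x<y
  Lex<-take-suc (suc q) (x ∷ xs) (.x ∷ ys) (tail< lt) = tail< (Lex<-take-suc q xs ys lt)

  Lex<-asym : (∀ {x y} → x < y → ¬ y < x) → ∀ {xs ys} → Lex< _<_ xs ys → ¬ Lex< _<_ ys xs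
  Lex<-asym <-asym (head< x<y) (head< y<x) = <-asym x<y y<x
  Lex<-asym <-asym (head< x<x) (tail< _)   = <-asym x<x x<x
  Lex<-asym <-asym (tail< _)   (head< x<x) = <-asym x<x x<x
  Lex<-asym <-asym (tail< lt)  (tail< gt)  = Lex<-asym <-asym lt gt

<ₑ-asym : ∀ {σ m} {x y : ExtSym σ m} → x <ₑ y → ¬ y <ₑ x
<ₑ-asym (sent<sent i<j) (sent<sent j<i) = ℕₚ.<-asym i<j j<i
<ₑ-asym (chr<chr c<d)   (chr<chr d<c)   = ℕₚ.<-asym c<d d<c

Lexₑ-asym : ∀ {σ m} {xs ys : List (ExtSym σ m)} → Lex< _<ₑ_ xs ys → ¬ Lex< _<ₑ_ ys xs
Lexₑ-asym = Lex<-asym <ₑ-asym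

Lexₑ-irrefl : ∀ {σ m} {xs : List (ExtSym σ m)} → ¬ Lex< _<ₑ_ xs xs
Lexₑ-irrefl lt = Lexₑ-asym lt lt

module PrefixOrder {σ k m : ℕ} (s : Fin m → Vec (Fin σ) k) where
  open Setup s

  ≺-asym : ∀ {p α β} → α ≺[ p ] β → ¬ β ≺[ p ] α
  ≺-asym (by-prefix lt)    (by-prefix gt)    = Lexₑ-asym lt gt
  ≺-asym (by-prefix lt)    (by-length eq _)  = Lexₑ-irrefl (subst (Lex< _<ₑ_ _) eq lt)
  ≺-asym (by-prefix lt)    (by-index eq _ _) = Lexₑ-irrefl (subst (Lex< _<ₑ_ _) eq lt)
  ≺-asym (by-length eq _)  (by-prefix gt)    = Lexₑ-irrefl (subst (Lex< _<ₑ_ _) eq gt)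
  ≺-asym (by-length _ lt)  (by-length _ gt)  = ℕₚ.<-asym lt gt
  ≺-asym (by-length _ lt)  (by-index _ eq _) = ℕₚ.<-irrefl (sym eq) lt
  ≺-asym (by-index eq _ _) (by-prefix gt)    = Lexₑ-irrefl (subst (Lex< _<ₑ_ _) eq gt)
  ≺-asym (by-index _ eq _) (by-length _ gt)  = ℕₚ.<-irrefl (sym eq) gt
  ≺-asym (by-index _ _ lt) (by-index _ _ gt) = ℕₚ.<-asym lt gt

  ≺⇒pre-≤ : ∀ {p α β} → α ≺[ p ] β → Lex< _<ₑ_ (pre p α) (pre p β) ⊎ pre p α ≡ pre p β
  ≺⇒pre-≤ (by-prefix lt)    = inj₁ lt
  ≺⇒pre-≤ (by-length eq _)  = inj₂ eq
  ≺⇒pre-≤ (by-index eq _ _) = inj₂ eq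

  ≺-samePre⇒len-≤ : ∀ {p α β} → pre p α ≡ pre p β → α ≺[ p ] β → len α ℕ.≤ len β
  ≺-samePre⇒len-≤ same (by-prefix lt)    = ⊥-elim (Lexₑ-irrefl (subst (Lex< _<ₑ_ _) (sym same) lt))
  ≺-samePre⇒len-≤ same (by-length _ lt)  = ℕₚ.<⇒≤ lt
  ≺-samePre⇒len-≤ same (by-index _ eq _) = ℕₚ.≤-reflexive eq

  ≺-samePreLen⇒idx< : ∀ {p α β} → pre p α ≡ pre p β → len α ≡ len β → α ≺[ p ] β → idx α F.< idx β
  ≺-samePreLen⇒idx< same _  (by-prefix lt)    = ⊥-elim (Lexₑ-irrefl (subst (Lex< _<ₑ_ _) (sym same) lt))
  ≺-samePreLen⇒idx< _    eq (by-length _ lt)  = ⊥-elim (ℕₚ.<-irrefl eq lt)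
  ≺-samePreLen⇒idx< _    _  (by-index _ _ lt) = lt

  length-sufStr : ∀ α → length (sufStr α) ≡ len α
  length-sufStr (l , j) = begin
    length (drop (k ∸ toℕ l) (toList (s j)))  ≡⟨ Lₚ.length-drop (k ∸ toℕ l) (toList (s j)) ⟩
    length (toList (s j)) ∸ (k ∸ toℕ l)       ≡⟨ cong (_∸ (k ∸ toℕ l)) (Vₚ.length-toList (s j)) ⟩
    k ∸ (k ∸ toℕ l)                           ≡⟨ ℕₚ.m∸[m∸n]≡n (ℕₚ.≤-pred (Fₚ.toℕ<n l)) ⟩
    toℕ l                                     ∎
    where open ≡-Reasoning

  length-ext : ∀ α → length (ext α) ≡ suc (len α)
  length-ext α = begin
    length (map chr (sufStr α) ++ [ sent (idx α) ])  ≡⟨ Lₚ.length-++ (map chr (sufStr α)) ⟩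
    length (map chr (sufStr α)) + 1                  ≡⟨ ℕₚ.+-comm _ 1 ⟩
    suc (length (map chr (sufStr α)))                ≡⟨ cong suc (Lₚ.length-map chr (sufStr α)) ⟩
    suc (length (sufStr α))                          ≡⟨ cong suc (length-sufStr α) ⟩
    suc (len α)                                      ∎
    where open ≡-Reasoning

  ext-at-len : ∀ {q} α → len α ≡ q → nth (ext α) q ≡ just (sent (idx α))
  ext-at-len α refl = subst (λ i → nth (ext α) i ≡ just (sent (idx α)))
    (trans (Lₚ.length-map chr (sufStr α)) (length-sufStr α))
    (nth-++-length (map chr (sufStr α)) (sent (idx α)) [])

  ext-beyond-len : ∀ {q} α → len α ℕ.< q → nth (ext α) q ≡ nothing
  ext-beyond-len α len<q = nth-beyond (ext α) (subst (ℕ._≤ _) (sym (length-ext α)) len<q)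

  Qsym-suc : ∀ q α → Qsym (suc q) α ≡ nth (sufStr α) q
  Qsym-suc q α with len α ℕ.<? suc q
  ... | yes len<1+q = sym (nth-beyond (sufStr α) (subst (ℕ._≤ q) (sym (length-sufStr α)) (ℕₚ.≤-pred len<1+q)))
  ... | no _        = refl

  ext-at-Qsym : ∀ {q} α {c} → Qsym (suc q) α ≡ just c → nth (ext α) q ≡ just (chr c)
  ext-at-Qsym {q} α {c} Q≡c = begin
    nth (map chr (sufStr α) ++ [ sent (idx α) ]) q  ≡⟨ nth-++ˡ (map chr (sufStr α)) _ q<len ⟩
    nth (map chr (sufStr α)) q                      ≡⟨ nth-map chr (sufStr α) q ⟩
    Maybe.map chr (nth (sufStr α) q)                ≡⟨ cong (Maybe.map chr) nth≡c ⟩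
    just (chr c)                                    ∎
    where
    open ≡-Reasoning
    nth≡c : nth (sufStr α) q ≡ just c
    nth≡c = trans (sym (Qsym-suc q α)) Q≡c
    q<len : q ℕ.< length (map chr (sufStr α))
    q<len = subst (q ℕ.<_) (sym (Lₚ.length-map chr (sufStr α))) (nth-just⇒< (sufStr α) q nth≡c)

  Qsym-$⇒len≤ : ∀ {q} α → Qsym (suc q) α ≡ nothing → len α ℕ.≤ q
  Qsym-$⇒len≤ {q} α Q≡$ =
    subst (ℕ._≤ q) (length-sufStr α) (nth-nothing⇒≤ (sufStr α) q (trans (sym (Qsym-suc q α)) Q≡$))

  pre-suc : ∀ q α → pre (suc q) α ≡ pre q α ++ fromMaybe (nth (ext α) q)
  pre-suc q α = take-suc q (ext α)

  ≺-suc-by-next : ∀ {q α β x y} → pre q α ≡ pre q β → nth (ext α) q ≡ x → nth (ext β) q ≡ y →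
                  Lex< _<ₑ_ (fromMaybe x) (fromMaybe y) → α ≺[ suc q ] β
  ≺-suc-by-next {q} {α} {β} same refl refl x<y =
    by-prefix (subst₂ (Lex< _<ₑ_) (sym (pre-suc q α)) (sym (pre-suc q β))
      (subst (λ w → Lex< _<ₑ_ (pre q α ++ _) (w ++ _)) same (Lex<-++ˡ (pre q α) x<y)))

  ≺-suc-same-next : ∀ {q α β} → pre q α ≡ pre q β → nth (ext α) q ≡ nth (ext β) q →
                    α ≺[ q ] β → α ≺[ suc q ] β
  ≺-suc-same-next {q} {α} {β} same sameNext = extend
    where
    same-suc : pre (suc q) α ≡ pre (suc q) β
    same-suc = begin
      pre (suc q) α                            ≡⟨ pre-suc q α ⟩
      pre q α ++ fromMaybe (nth (ext α) q)     ≡⟨ cong₂ _++_ same (cong fromMaybe sameNext) ⟩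
      pre q β ++ fromMaybe (nth (ext β) q)     ≡⟨ sym (pre-suc q β) ⟩
      pre (suc q) β                            ∎
      where open ≡-Reasoning
    extend : α ≺[ q ] β → α ≺[ suc q ] β
    extend (by-prefix lt)       = ⊥-elim (Lexₑ-irrefl (subst (Lex< _<ₑ_ _) (sym same) lt))
    extend (by-length _ l<l)    = by-length same-suc l<l
    extend (by-index _ l≡l i<i) = by-index same-suc l≡l i<i

  ≺-suc-across : ∀ {q α β} → α ≺[ q ] β → pre q α ≢ pre q β → α ≺[ suc q ] β
  ≺-suc-across {q} {α} {β} (by-prefix lt) _ = by-prefix (Lex<-take-suc q (ext α) (ext β) lt)
  ≺-suc-across (by-length same _)  differ   = ⊥-elim (differ same)
  ≺-suc-across (by-index same _ _) differ   = ⊥-elim (differ same)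

  ≺-suc-by-Q : ∀ {q α β} → pre q α ≡ pre q β → Qsym (suc q) α <Q Qsym (suc q) β → α ≺[ suc q ] β
  ≺-suc-by-Q {q} {α} {β} same lt with Qsym (suc q) α in Qα | Qsym (suc q) β in Qβ
  ≺-suc-by-Q {α = α} {β} same $<c | nothing | just c with ℕₚ.m≤n⇒m<n∨m≡n (Qsym-$⇒len≤ α Qα)
  ... | inj₁ len<q = ≺-suc-by-next same (ext-beyond-len _ len<q) (ext-at-Qsym β Qβ) []<∷
  ... | inj₂ len≡q = ≺-suc-by-next same (ext-at-len _ len≡q) (ext-at-Qsym β Qβ) (head< sent<chr)
  ≺-suc-by-Q {α = α} {β} same (c<c c<d) | just c | just d =
    ≺-suc-by-next same (ext-at-Qsym α Qα) (ext-at-Qsym β Qβ) (head< (chr<chr c<d))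

  -- Q^(q+1) = $ hides two cases: the (q+1)-th extended symbol is the suffix's own sentinel
  -- (len = q), or it does not exist (len < q).
  ≺-suc-short : ∀ {q α β} → pre q α ≡ pre q β → len α ℕ.≤ q → len β ℕ.≤ q →
                α ≺[ q ] β → α ≺[ suc q ] β
  ≺-suc-short {q} {α} {β} same α≤q β≤q r with ℕₚ.m≤n⇒m<n∨m≡n α≤q | ℕₚ.m≤n⇒m<n∨m≡n β≤q
  ... | inj₁ α<q | inj₁ β<q =
    ≺-suc-same-next same (trans (ext-beyond-len α α<q) (sym (ext-beyond-len β β<q))) r
  ... | inj₁ α<q | inj₂ β≡q = ≺-suc-by-next same (ext-beyond-len α α<q) (ext-at-len β β≡q) []<∷
  ... | inj₂ α≡q | inj₁ β<q =
    ⊥-elim (ℕₚ.<⇒≱ β<q (subst (ℕ._≤ len β) α≡q (≺-samePre⇒len-≤ same r)))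
  ... | inj₂ α≡q | inj₂ β≡q = ≺-suc-by-next same (ext-at-len α α≡q) (ext-at-len β β≡q)
    (head< (sent<sent (≺-samePreLen⇒idx< same (trans α≡q (sym β≡q)) r)))

  ≺-suc-stable : ∀ {q α β} → pre q α ≡ pre q β → Qsym (suc q) α ≡ Qsym (suc q) β →
                 α ≺[ q ] β → α ≺[ suc q ] β
  ≺-suc-stable {q} {α} {β} same sameQ r with Qsym (suc q) α in Qα
  ... | just c  = ≺-suc-same-next same (trans (ext-at-Qsym α Qα) (sym (ext-at-Qsym β (sym sameQ)))) r
  ... | nothing = ≺-suc-short same (Qsym-$⇒len≤ α Qα) (Qsym-$⇒len≤ β (sym sameQ)) r

strictMono⇒inflationary : ∀ {m n} {f : Fin m → Fin n} → f Preserves F._<_ ⟶ F._<_ → ∀ i → toℕ i ℕ.≤ toℕ (f i)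
strictMono⇒inflationary         f-mono F.zero    = z≤n
strictMono⇒inflationary f-mono (F.suc i) =
  ℕₚ.≤-<-trans (strictMono⇒inflationary (f-mono ∘ inject₁-mono) i) (f-mono (Fₚ.≤̄⇒inject₁< ℕₚ.≤-refl))
  where
  inject₁-mono : ∀ {i j} → i F.< j → inject₁ i F.< inject₁ j
  inject₁-mono {i} {j} = subst₂ ℕ._<_ (sym (Fₚ.toℕ-inject₁ i)) (sym (Fₚ.toℕ-inject₁ j))

injective-below⇒≤ : ∀ {n n'} (h : Fin n → Fin n') → Injective _≡_ _≡_ h → ∀ {a b} → a ℕ.≤ n →
                    (∀ k → toℕ k ℕ.< a → toℕ (h k) ℕ.< b) → a ℕ.≤ b
injective-below⇒≤ {n} h h-inj {a} {b} a≤n h-below = Fₚ.injective⇒≤ g-inj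
  where
  embed : Fin a → Fin n
  embed k = inject≤ k a≤n
  g : Fin a → Fin b
  g k = fromℕ< (h-below (embed k) (subst (ℕ._< a) (sym (Fₚ.toℕ-inject≤ k a≤n)) (Fₚ.toℕ<n k)))
  g-inj : Injective _≡_ _≡_ g
  g-inj {k} {k'} gk≡gk' = Fₚ.inject≤-injective a≤n a≤n k k' (h-inj (Fₚ.toℕ-injective
    (trans (sym (Fₚ.toℕ-fromℕ< _)) (trans (cong toℕ gk≡gk') (Fₚ.toℕ-fromℕ< _)))))

section-injective : ∀ {A B : Set} (f : B → A) (f-onto : ∀ a → ∃[ b ] f b ≡ a) →
                    Injective _≡_ _≡_ (proj₁ ∘ f-onto)
section-injective f f-onto {a} {a'} eq =
  trans (sym (proj₂ (f-onto a))) (trans (cong f eq) (proj₂ (f-onto a')))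

module Enumeration {A : Set} (_≺_ : A → A → Set) (≺-asym : ∀ {x y} → x ≺ y → ¬ y ≺ x) where

  ≺-irrefl : ∀ {x} → ¬ x ≺ x
  ≺-irrefl x≺x = ≺-asym x≺x x≺x

  Increasing : ∀ {n} → (Fin n → A) → Set
  Increasing X = X Preserves F._<_ ⟶ _≺_

  module _ {n} {X : Fin n → A} (X↑ : Increasing X) where

    increasing-reflects : ∀ {i j} → X i ≺ X j → i F.< j
    increasing-reflects {i} {j} Xi≺Xj with Fₚ.<-cmp i j
    ... | tri< i<j _ _ = i<j
    ... | tri≈ _ refl _ = ⊥-elim (≺-irrefl Xi≺Xj)
    ... | tri> _ _ j<i = ⊥-elim (≺-asym Xi≺Xj (X↑ j<i))

    increasing⇒injective : Injective _≡_ _≡_ X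
    increasing⇒injective {i} {j} Xi≡Xj with Fₚ.<-cmp i j
    ... | tri< i<j _ _ = ⊥-elim (≺-irrefl (subst (_≺ X j) Xi≡Xj (X↑ i<j)))
    ... | tri≈ _ i≡j _ = i≡j
    ... | tri> _ _ j<i = ⊥-elim (≺-irrefl (subst (X j ≺_) Xi≡Xj (X↑ j<i)))

  -- Reindexing Z through X gives a strictly monotone map of Fin n, hence one that never
  -- decreases an index; applied to both reindexings this forces the identity.
  increasing-unique : ∀ {n} {X Z : Fin n → A} → Increasing X → Increasing Z →
                      (∀ r → ∃[ r' ] Z r ≡ X r') → (∀ r → ∃[ r' ] X r ≡ Z r') → ∀ r → X r ≡ Z r
  increasing-unique {n} {X} {Z} X↑ Z↑ Z⊆X X⊆Z r = trans (proj₂ (X⊆Z r)) (cong Z g[r]≡r)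
    where
    f g : Fin n → Fin n
    f r = proj₁ (Z⊆X r)
    g r = proj₁ (X⊆Z r)
    f-mono : f Preserves F._<_ ⟶ F._<_
    f-mono {i} {j} i<j = increasing-reflects X↑ (subst₂ _≺_ (proj₂ (Z⊆X i)) (proj₂ (Z⊆X j)) (Z↑ i<j))
    g-mono : g Preserves F._<_ ⟶ F._<_
    g-mono {i} {j} i<j = increasing-reflects Z↑ (subst₂ _≺_ (proj₂ (X⊆Z i)) (proj₂ (X⊆Z j)) (X↑ i<j))
    f∘g≡id : f (g r) ≡ r
    f∘g≡id = increasing⇒injective X↑ (sym (trans (proj₂ (X⊆Z r)) (proj₂ (Z⊆X (g r)))))
    g[r]≡r : g r ≡ r
    g[r]≡r = Fₚ.toℕ-injective (ℕₚ.≤-antisym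
      (subst (λ i → toℕ (g r) ℕ.≤ toℕ i) f∘g≡id (strictMono⇒inflationary f-mono (g r)))
      (strictMono⇒inflationary g-mono r))

  module Cut {n} {X Xp : Fin n → A} (X↑ : Increasing X) (Xp-inj : Injective _≡_ _≡_ Xp)
             (X-onto : ∀ a → ∃[ j ] X j ≡ a) (Xp-onto : ∀ a → ∃[ i ] Xp i ≡ a)
             {t : ℕ} (cut : ∀ i i' → toℕ i ℕ.< t → t ℕ.≤ toℕ i' → Xp i ≺ Xp i') where

    -- X[0..j] then lies below the cut, which holds only t elements.
    cut-preserved : ∀ {j i} → X j ≡ Xp i → toℕ i ℕ.< t → toℕ j ℕ.< t
    cut-preserved {j} {i} Xj≡Xpi i<t = injective-below⇒≤ h h-inj (Fₚ.toℕ<n j) h-below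
      where
      h : Fin n → Fin n
      h = proj₁ ∘ Xp-onto ∘ X
      h-inj : Injective _≡_ _≡_ h
      h-inj = increasing⇒injective X↑ ∘ section-injective Xp Xp-onto
      h-below : ∀ k → toℕ k ℕ.< suc (toℕ j) → toℕ (h k) ℕ.< t
      h-below k k≤j with toℕ (h k) ℕ.<? t
      ... | yes hk<t = hk<t
      ... | no hk≮t  = ⊥-elim (ℕₚ.<⇒≱ (increasing-reflects X↑ Xj≺Xk) (ℕₚ.≤-pred k≤j))
        where
        Xj≺Xk : X j ≺ X k
        Xj≺Xk = subst₂ _≺_ (sym Xj≡Xpi) (proj₂ (Xp-onto (X k))) (cut i (h k) i<t (ℕₚ.≮⇒≥ hk≮t))

    -- Otherwise all t elements below the cut would sit at X-positions before j < t.
    cut-reflected : ∀ {j i} → X j ≡ Xp i → toℕ j ℕ.< t → toℕ i ℕ.< t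
    cut-reflected {j} {i} Xj≡Xpi j<t with toℕ i ℕ.<? t
    ... | yes i<t = i<t
    ... | no i≮t  = ⊥-elim (ℕₚ.<⇒≱ j<t (injective-below⇒≤ pos pos-inj t≤n pos-below))
      where
      t≤i : t ℕ.≤ toℕ i
      t≤i = ℕₚ.≮⇒≥ i≮t
      t≤n : t ℕ.≤ n
      t≤n = ℕₚ.≤-trans t≤i (ℕₚ.<⇒≤ (Fₚ.toℕ<n i))
      pos : Fin n → Fin n
      pos = proj₁ ∘ X-onto ∘ Xp
      pos-inj : Injective _≡_ _≡_ pos
      pos-inj = Xp-inj ∘ section-injective X X-onto
      pos-below : ∀ k → toℕ k ℕ.< t → toℕ (pos k) ℕ.< toℕ j
      pos-below k k<t with Fₚ.<-cmp (pos k) j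
      ... | tri< pk<j _ _ = pk<j
      ... | tri≈ _ pk≡j _ = ⊥-elim (ℕₚ.<⇒≱ k<t (subst (λ i' → t ℕ.≤ toℕ i') (sym k≡i) t≤i))
        where
        k≡i : k ≡ i
        k≡i = Xp-inj (trans (sym (proj₂ (X-onto (Xp k)))) (trans (cong X pk≡j) Xj≡Xpi))
      ... | tri> _ _ j<pk = ⊥-elim (≺-asym (cut k i k<t t≤i)
              (subst₂ _≺_ Xj≡Xpi (proj₂ (X-onto (Xp k))) (X↑ j<pk)))

module Refinement {σ k m : ℕ} (s : Fin m → Vec (Fin σ) k) (q : ℕ) where
  open Setup s
  open PrefixOrder s

  Boundary : (Fin N → Suffix) → ℕ → Set
  Boundary Xprev t = ∀ u v → suc (toℕ u) ≡ t → toℕ v ≡ t → pre q (Xprev u) ≢ pre q (Xprev v)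

  module _ {Xprev : Fin N → Suffix} (Xprev↑ : ∀ (i i' : Fin N) → i F.< i' → Xprev i ≺[ q ] Xprev i') where

    pre-monotone : ∀ {i j} → i F.≤ j →
                   Lex< _<ₑ_ (pre q (Xprev i)) (pre q (Xprev j)) ⊎ pre q (Xprev i) ≡ pre q (Xprev j)
    pre-monotone {i} {j} i≤j with ℕₚ.m≤n⇒m<n∨m≡n i≤j
    ... | inj₁ i<j = ≺⇒pre-≤ (Xprev↑ i j i<j)
    ... | inj₂ i≡j = inj₂ (cong (pre q ∘ Xprev) (Fₚ.toℕ-injective i≡j))

    pre-convex : ∀ {i j l} → i F.≤ j → j F.≤ l →
                 pre q (Xprev i) ≡ pre q (Xprev l) → pre q (Xprev i) ≡ pre q (Xprev j)
    pre-convex i≤j j≤l same with pre-monotone i≤j | pre-monotone j≤l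
    ... | inj₂ i~j | _        = i~j
    ... | inj₁ i<j | inj₁ j<l = ⊥-elim (Lexₑ-asym i<j (subst (Lex< _<ₑ_ _) (sym same) j<l))
    ... | inj₁ i<j | inj₂ j~l = ⊥-elim (Lexₑ-irrefl (subst (Lex< _<ₑ_ _) (trans j~l (sym same)) i<j))

    -- By convexity of q-prefixes, a common prefix across a boundary would spread to the
    -- adjacent pair at the boundary; so the pair is ordered by its q-prefixes alone.
    ≺-suc-across-boundary : ∀ {t} → Boundary Xprev t →
                            ∀ i i' → toℕ i ℕ.< t → t ℕ.≤ toℕ i' → Xprev i ≺[ suc q ] Xprev i'
    ≺-suc-across-boundary {suc t} boundary i i' (s≤s i≤t) t<i' =
      ≺-suc-across (Xprev↑ i i' (ℕₚ.≤-<-trans i≤t t<i')) differ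
      where
      u v : Fin N
      u = fromℕ< (ℕₚ.<-trans t<i' (Fₚ.toℕ<n i'))
      v = fromℕ< (ℕₚ.≤-<-trans t<i' (Fₚ.toℕ<n i'))
      toℕu : toℕ u ≡ t
      toℕu = Fₚ.toℕ-fromℕ< _
      toℕv : toℕ v ≡ suc t
      toℕv = Fₚ.toℕ-fromℕ< _
      differ : pre q (Xprev i) ≢ pre q (Xprev i')
      differ same = boundary u v (cong suc toℕu) toℕv (trans
        (sym (pre-convex (subst (toℕ i ℕ.≤_) (sym toℕu) i≤t)
                         (subst (ℕ._≤ toℕ i') (sym toℕu) (ℕₚ.<⇒≤ t<i')) same))
        (pre-convex (subst (toℕ i ℕ.≤_) (sym toℕv) (ℕₚ.m≤n⇒m≤1+n i≤t))
                    (subst (ℕ._≤ toℕ i') (sym toℕv) t<i') same))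

  module Window {Xprev X : Fin N → Suffix} (prev : IsInterleave q Xprev) (next : IsInterleave (suc q) X)
                {b e : Fin N} (seg : IsSegment q Xprev b e)
                {π : Fin (suc (toℕ e ∸ toℕ b)) → Fin N} (sort : IsStableSort (Q (suc q) Xprev) b e π) where

    module Prev = Enumeration (λ α β → α ≺[ q ] β) ≺-asym
    module Next = Enumeration (λ α β → α ≺[ suc q ] β) ≺-asym

    Xprev↑ : Prev.Increasing Xprev
    Xprev↑ {i} {i'} = proj₂ prev i i'

    X↑ : Next.Increasing X
    X↑ {i} {i'} = proj₂ next i i'

    b≤e : b F.≤ e
    b≤e = proj₁ seg

    samePre-in-segment : ∀ {i} → b F.≤ i → i F.≤ e → pre q (Xprev i) ≡ pre q (Xprev b)
    samePre-in-segment {i} = proj₁ (proj₂ seg) i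

    boundary-at-b : Boundary Xprev (toℕ b)
    boundary-at-b u v su≡b v≡b = subst (λ w → pre q (Xprev u) ≢ pre q (Xprev w))
      (sym (Fₚ.toℕ-injective v≡b)) (proj₁ (proj₂ (proj₂ seg)) u su≡b)

    boundary-after-e : Boundary Xprev (suc (toℕ e))
    boundary-after-e u v su≡se v≡se = subst (λ w → pre q (Xprev w) ≢ pre q (Xprev v))
      (sym (Fₚ.toℕ-injective (ℕₚ.suc-injective su≡se))) (proj₂ (proj₂ (proj₂ seg)) v v≡se ∘ sym)

    module AtB = Next.Cut X↑ (Prev.increasing⇒injective Xprev↑) (proj₁ next) (proj₁ prev)
                   (≺-suc-across-boundary (proj₂ prev) boundary-at-b)
    module AtE = Next.Cut X↑ (Prev.increasing⇒injective Xprev↑) (proj₁ next) (proj₁ prev)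
                   (≺-suc-across-boundary (proj₂ prev) boundary-after-e)

    in-window⇒ : ∀ {j i} → X j ≡ Xprev i → b F.≤ j → j F.≤ e → b F.≤ i × i F.≤ e
    in-window⇒ Xj≡Xprevi b≤j j≤e =
      ℕₚ.≮⇒≥ (λ i<b → ℕₚ.<⇒≱ (AtB.cut-preserved Xj≡Xprevi i<b) b≤j) ,
      ℕₚ.≤-pred (AtE.cut-reflected Xj≡Xprevi (s≤s j≤e))

    in-window⇐ : ∀ {j i} → X j ≡ Xprev i → b F.≤ i → i F.≤ e → b F.≤ j × j F.≤ e
    in-window⇐ Xj≡Xprevi b≤i i≤e =
      ℕₚ.≮⇒≥ (λ j<b → ℕₚ.<⇒≱ (AtB.cut-reflected Xj≡Xprevi j<b) b≤i) ,
      ℕₚ.≤-pred (AtE.cut-preserved Xj≡Xprevi (s≤s i≤e))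

    W : ℕ
    W = suc (toℕ e ∸ toℕ b)

    b+r≤e : ∀ (r : Fin W) → toℕ b + toℕ r ℕ.≤ toℕ e
    b+r≤e r = subst (toℕ b + toℕ r ℕ.≤_) (ℕₚ.m+[n∸m]≡n b≤e)
                    (ℕₚ.+-monoʳ-≤ (toℕ b) (ℕₚ.≤-pred (Fₚ.toℕ<n r)))

    shift : Fin W → Fin N
    shift r = fromℕ< (ℕₚ.≤-<-trans (b+r≤e r) (Fₚ.toℕ<n e))

    toℕ-shift : ∀ r → toℕ (shift r) ≡ toℕ b + toℕ r
    toℕ-shift r = Fₚ.toℕ-fromℕ< _

    shift-in-window : ∀ r → b F.≤ shift r × shift r F.≤ e
    shift-in-window r = subst (toℕ b ℕ.≤_) (sym (toℕ-shift r)) (ℕₚ.m≤m+n _ _) ,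
                        subst (ℕ._≤ toℕ e) (sym (toℕ-shift r)) (b+r≤e r)

    unshift : ∀ (j : Fin N) → j F.≤ e → Fin W
    unshift j j≤e = fromℕ< (s≤s (ℕₚ.∸-monoˡ-≤ (toℕ b) j≤e))

    shift-unshift : ∀ {j} → b F.≤ j → (j≤e : j F.≤ e) → shift (unshift j j≤e) ≡ j
    shift-unshift {j} b≤j j≤e = Fₚ.toℕ-injective (begin
      toℕ (shift (unshift j j≤e))          ≡⟨ toℕ-shift _ ⟩
      toℕ b + toℕ (unshift j j≤e)          ≡⟨ cong (toℕ b +_) (Fₚ.toℕ-fromℕ< _) ⟩
      toℕ b + (toℕ j ∸ toℕ b)              ≡⟨ ℕₚ.m+[n∸m]≡n b≤j ⟩
      toℕ j                                ∎)
      where open ≡-Reasoning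

    Xwindow Zwindow : Fin W → Suffix
    Xwindow = X ∘ shift
    Zwindow = Xprev ∘ π

    Xwindow↑ : Next.Increasing Xwindow
    Xwindow↑ {r} {r'} r<r' =
      X↑ (subst₂ ℕ._<_ (sym (toℕ-shift r)) (sym (toℕ-shift r')) (ℕₚ.+-monoʳ-< (toℕ b) r<r'))

    π-in-window : ∀ r → b F.≤ π r × π r F.≤ e
    π-in-window = proj₁ sort

    Zwindow-samePre : ∀ r r' → pre q (Zwindow r) ≡ pre q (Zwindow r')
    Zwindow-samePre r r' = trans (uncurry samePre-in-segment (π-in-window r))
                                 (sym (uncurry samePre-in-segment (π-in-window r')))

    Zwindow↑ : Next.Increasing Zwindow
    Zwindow↑ {r} {r'} r<r' with proj₂ (proj₂ sort) r r' r<r'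
    ... | inj₁ Q<Q         = ≺-suc-by-Q (Zwindow-samePre r r') Q<Q
    ... | inj₂ (Q≡Q , π<π) = ≺-suc-stable (Zwindow-samePre r r') Q≡Q (Xprev↑ π<π)

    Zwindow⊆Xwindow : ∀ r → ∃[ r' ] Zwindow r ≡ Xwindow r'
    Zwindow⊆Xwindow r with proj₁ next (Zwindow r)
    ... | j , Xj≡Zr with in-window⇐ Xj≡Zr (proj₁ (π-in-window r)) (proj₂ (π-in-window r))
    ...   | b≤j , j≤e = unshift j j≤e , trans (sym Xj≡Zr) (cong X (sym (shift-unshift b≤j j≤e)))

    Xwindow⊆Zwindow : ∀ r → ∃[ r' ] Xwindow r ≡ Zwindow r'
    Xwindow⊆Zwindow r with proj₁ prev (Xwindow r)
    ... | i , Xprevi≡Xr with uncurry (in-window⇒ (sym Xprevi≡Xr)) (shift-in-window r)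
    ...   | b≤i , i≤e with proj₁ (proj₂ sort) i b≤i i≤e
    ...     | r' , πr'≡i = r' , trans (sym Xprevi≡Xr) (cong Xprev (sym πr'≡i))

    X-on-window : ∀ r i → toℕ i ≡ toℕ b + toℕ r → X i ≡ Xprev (π r)
    X-on-window r i i≡b+r = trans (cong X (Fₚ.toℕ-injective (trans i≡b+r (sym (toℕ-shift r)))))
      (Next.increasing-unique Xwindow↑ Zwindow↑ Zwindow⊆Xwindow Xwindow⊆Zwindow r)

    X-window⊆Xprev-window : ∀ i → b F.≤ i → i F.≤ e → ∃[ i' ] (b F.≤ i' × i' F.≤ e × X i ≡ Xprev i')
    X-window⊆Xprev-window i b≤i i≤e with proj₁ prev (X i)
    ... | i' , Xprevi'≡Xi with in-window⇒ (sym Xprevi'≡Xi) b≤i i≤e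
    ...   | b≤i' , i'≤e = i' , b≤i' , i'≤e , sym Xprevi'≡Xi

    Xprev-window⊆X-window : ∀ i' → b F.≤ i' → i' F.≤ e → ∃[ i ] (b F.≤ i × i F.≤ e × X i ≡ Xprev i')
    Xprev-window⊆X-window i' b≤i' i'≤e with proj₁ next (Xprev i')
    ... | i , Xi≡Xprevi' with in-window⇐ Xi≡Xprevi' b≤i' i'≤e
    ...   | b≤i , i≤e = i , b≤i , i≤e , Xi≡Xprevi'

mainTheorem2 : {σ k m : ℕ} (s : Fin m → Vec (Fin σ) k) (p : ℕ) → p ≥ 1 →
    let open Setup s in
    (Xprev X : Fin N → Suffix) → IsInterleave (p ∸ 1) Xprev → IsInterleave p X →
    (b e : Fin N) → IsSegment (p ∸ 1) Xprev b e →
    (π : Fin (suc (toℕ e ∸ toℕ b)) → Fin N) → IsStableSort (Q p Xprev) b e π →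
    ((∀ (i : Fin N) → b F.≤ i → i F.≤ e → ∃[ i' ] (b F.≤ i' × i' F.≤ e × X i ≡ Xprev i'))
     × (∀ (i' : Fin N) → b F.≤ i' → i' F.≤ e → ∃[ i ] (b F.≤ i × i F.≤ e × X i ≡ Xprev i')))
    × (∀ (r : Fin (suc (toℕ e ∸ toℕ b))) (i : Fin N) →
         toℕ i ≡ toℕ b + toℕ r → X i ≡ Xprev (π r))
mainTheorem2 s (suc q) (s≤s z≤n) Xprev X prev next b e seg π sort =
  (X-window⊆Xprev-window , Xprev-window⊆X-window) , X-on-window
  where open Refinement.Window s q prev next seg sort
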